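{- Let $G$ be a finite simple undirected connected AT-free graph of girth at least $5$, let $x,y$ be a dominating pair with $\mathrm{dist}(x,y)=\mathrm{diam}(G)$, and let $P$ be a shortest $x$-$y$ path with vertices $u_1=x,\dots,u_d=y$ in order. For $1\le i\le d$ let $S_i=\{v\notin V(P): u_i\in N_G(v)\}$, and let $S$ be the set of vertices $v\notin V(P)$ having a neighbour outside $V(P)$. Define intervals $g_2(v)$: $g_2(u_i)=[1,2]$ if $i$ is odd and $[2,3]$ if $i$ is even; for $v\in S_i\setminus S$, $g_2(v)=[\frac54,\frac74]$ if $i$ is odd and $[\frac94,\frac{11}4]$ if $i$ is even; for $v\in S_i\cap S$, $g_2(v)=[0,1]$ if $i$ is odd and $[3,4]$ if $i$ is even. Let $I_2$ be the interval graph on $V(G)$ in which distinct $u,v$ are adjacent iff $g_2(u)\cap g_2(v)\neq\emptyset$. Then $E(G)\subseteq E(I_2)$.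
   Context: $G$ is AT-free if it has no asteroidal triple (independent set of three vertices such that between each pair there is a path avoiding the neighbourhood of the third). A pair $x,y$ is a dominating pair if the vertex set of every $x$-$y$ path is a dominating set. $N_G(v)$ is the neighbourhood of $v$. (In this setting each vertex outside $V(P)$ lies in exactly one $S_i$.) -}

module Defs where

open import Data.Nat using (ℕ; zero; suc; _≤_; _%_)
open import Data.Fin using (Fin; zero; suc; toℕ; inject₁; fromℕ)
open import Data.Product using (Σ; ∃; ∃-syntax; _×_; _,_)
open import Data.Sum using (_⊎_)
open import Data.Empty using (⊥)
open import Relation.Nullary using (¬_)
open import Relation.Binary.PropositionalEquality using (_≡_; _≢_)
open import Function.Definitions using (Injective)
open import Data.Integer using (+_)
open import Data.Rational using (ℚ; _/_) renaming (_≤_ to _≤ℚ_)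

record Graph : Set₁ where
  field
    n      : ℕ
    Adj    : Fin n → Fin n → Set
    sym    : ∀ {u v} → Adj u v → Adj v u
    irrefl : ∀ {u} → ¬ Adj u u

module _ (G : Graph) where
  open Graph G

  V : Set
  V = Fin n

  record Path (k : ℕ) : Set where
    field
      vertex  : Fin (suc k) → V
      inj     : Injective _≡_ _≡_ vertex
      adj     : ∀ (i : Fin k) → Adj (vertex (inject₁ i)) (vertex (suc i))

  open Path public

  start end : ∀ {k} → Path k → V
  start p = vertex p zero
  end {k} p = vertex p (fromℕ k)

  OnPath : ∀ {k} → Path k → V → Set
  OnPath p v = ∃[ i ] vertex p i ≡ v

  IsPathBetween : ∀ {k} → Path k → V → V → Set
  IsPathBetween p a b = start p ≡ a × end p ≡ b

  Connected : Set
  Connected = ∀ a b → ∃[ k ] Σ (Path k) λ p → IsPathBetween p a b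

  IsDist : V → V → ℕ → Set
  IsDist a b m =
    (Σ (Path m) λ p → IsPathBetween p a b) ×
    (∀ k (q : Path k) → IsPathBetween q a b → m ≤ k)

  IsDiametral : V → V → Set
  IsDiametral a b = ∃[ m ] (IsDist a b m × (∀ c e m' → IsDist c e m' → m' ≤ m))

  IsShortestPath : ∀ {k} → Path k → V → V → Set
  IsShortestPath {k} p a b =
    IsPathBetween p a b × (∀ k' (q : Path k') → IsPathBetween q a b → k ≤ k')

  -- a cycle with k vertices (k ≥ 3): a path vertex 0 … vertex (k-1) plus the closing edge
  HasCycleOfLength : ℕ → Set
  HasCycleOfLength (suc (suc (suc j))) =
    Σ (Path (suc (suc j))) λ p → Adj (end p) (start p)
  HasCycleOfLength _ = ⊥

  GirthAtLeast : ℕ → Set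
  GirthAtLeast g = ∀ k → HasCycleOfLength k → g ≤ k

  AvoidsN : ∀ {k} → Path k → V → Set
  AvoidsN p c = ∀ i → ¬ Adj (vertex p i) c

  IsAsteroidalTriple : V → V → V → Set
  IsAsteroidalTriple a b c =
    a ≢ b × b ≢ c × a ≢ c ×
    ¬ Adj a b × ¬ Adj b c × ¬ Adj a c ×
    (∃[ k ] Σ (Path k) λ p → IsPathBetween p a b × AvoidsN p c) ×
    (∃[ k ] Σ (Path k) λ p → IsPathBetween p b c × AvoidsN p a) ×
    (∃[ k ] Σ (Path k) λ p → IsPathBetween p a c × AvoidsN p b)

  ATFree : Set
  ATFree = ∀ a b c → ¬ IsAsteroidalTriple a b c

  Dominating : (V → Set) → Set
  Dominating D = ∀ v → D v ⊎ (∃[ w ] (D w × Adj v w))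

  IsDominatingPair : V → V → Set
  IsDominatingPair a b = ∀ k (p : Path k) → IsPathBetween p a b → Dominating (OnPath p)

  Interval : Set
  Interval = ℚ × ℚ

  _∈I_ : ℚ → Interval → Set
  q ∈I (lo , hi) = lo ≤ℚ q × q ≤ℚ hi

  Meet : Interval → Interval → Set
  Meet J K = ∃[ q ] (q ∈I J × q ∈I K)

  -- Construction relative to a path P = u_1 … u_d (u_{i+1} = vertex P i, i : Fin d, d = L+1)
  module Construction {L : ℕ} (P : Path L) where

    u : Fin (suc L) → V
    u = vertex P

    InSi : Fin (suc L) → V → Set
    InSi i v = ¬ OnPath P v × Adj v (u i)

    InSet : V → Set
    InSet v = ¬ OnPath P v × ∃[ w ] (¬ OnPath P w × Adj v w)

    -- u_{i+1} has odd (1-based) index i+1 iff toℕ i is even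
    Odd1 : Fin (suc L) → Set
    Odd1 i = toℕ i % 2 ≡ 0

    Even1 : Fin (suc L) → Set
    Even1 i = toℕ i % 2 ≡ 1

    -- g₂ v ≡ J  (as a relation; well-defined since each v ∉ V(P) lies in exactly one S_i)
    data g₂ : V → Interval → Set where
      path-odd  : ∀ i → Odd1 i  → g₂ (u i) (+ 1 / 1 , + 2 / 1)
      path-even : ∀ i → Even1 i → g₂ (u i) (+ 2 / 1 , + 3 / 1)
      noS-odd   : ∀ i v → InSi i v → ¬ InSet v → Odd1 i  → g₂ v (+ 5 / 4 , + 7 / 4)
      noS-even  : ∀ i v → InSi i v → ¬ InSet v → Even1 i → g₂ v (+ 9 / 4 , + 11 / 4)
      S-odd     : ∀ i v → InSi i v → InSet v → Odd1 i  → g₂ v (+ 0 / 1 , + 1 / 1)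
      S-even    : ∀ i v → InSi i v → InSet v → Even1 i → g₂ v (+ 3 / 1 , + 4 / 1)

    AdjI₂ : V → V → Set
    AdjI₂ a b = a ≢ b × (∀ J K → g₂ a J → g₂ b K → Meet J K)

module Submission where

-- Let P = u_1 … u_d be a shortest x-y path in a graph G of girth at least 5.
-- An edge of G gets disjoint g₂-intervals only in three situations:
--   (a) v ∉ V(P) lies in S_i and is adjacent to u_j with i ≢ j (mod 2);
--   (b) an edge vw outside P has v ∈ S_i, w ∈ S_j with i ≢ j (mod 2);
--   (c) a vertex of S_i ∖ S is adjacent to a vertex outside P,
--       which the definition of S forbids.
-- In (a) and (b) the attachment points are an odd distance apart. Distance 1
-- closes a triangle (a) or a 4-cycle (b); distance 3 in (b) gives the
-- asteroidal triple u_i, u_{i+2}, w; any larger distance lets the detour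
-- through v (and w) shorten P.
-- The file builds paths from vertex lists and by gluing ℕ-indexed paths,
-- proves the detour lemma and a parity lemma, derives (a) and (b), and checks
-- the 36 pairs of interval labels.

open import Defs
open import Data.Nat using (ℕ; zero; suc; _+_; _∸_; _*_; _<_; _≤_; _%_; z≤n; s≤s; _≤?_; _≟_)
open import Data.Nat.Properties
open import Data.Nat.DivMod using (_mod_; m<n⇒m%n≡m; %-remove-+ˡ)
open import Data.Nat.Divisibility using (n∣m*n)
open import Data.Fin using (Fin; zero; suc; toℕ; inject₁; fromℕ; fromℕ<)
open import Data.Fin.Properties using (toℕ-injective; toℕ<n; toℕ≤pred[n]; toℕ-fromℕ; toℕ-fromℕ<; toℕ-inject₁)
open import Data.List using (List; []; _∷_; length; lookup)
open import Data.List.Relation.Unary.All as All using ([]; _∷_)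
open import Data.List.Relation.Unary.AllPairs using ([]; _∷_)
open import Data.List.Relation.Unary.Unique.Propositional using (Unique)
open import Data.List.Relation.Unary.Linked using (Linked; [-]; _∷_)
open import Data.List.Membership.Propositional.Properties using (∈-lookup)
open import Data.Product using (∃-syntax; _×_; _,_; proj₁; proj₂)
open import Data.Sum using (_⊎_; inj₁; inj₂)
open import Data.Empty using (⊥; ⊥-elim)
open import Data.Integer using (+_)
open import Data.Rational using (ℚ; _/_) renaming (_≤?_ to _≤ℚ?_)
open import Relation.Nullary using (¬_; yes; no; contradiction)
open import Relation.Nullary.Decidable using (True; toWitness)
open import Relation.Binary.PropositionalEquality

halve : ∀ s → ∃[ d ] (s ≡ d * 2 ⊎ s ≡ suc (d * 2))
halve zero = 0 , inj₁ refl
halve (suc s) with halve s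
... | d , inj₁ refl = d , inj₂ refl
... | d , inj₂ refl = suc d , inj₁ refl

oddDistance : ∀ {a b} → a ≤ b → a % 2 ≢ b % 2 → ∃[ d ] b ≡ suc (d * 2) + a
oddDistance {a} {b} a≤b differ with b ∸ a | halve (b ∸ a) | m∸n+n≡m a≤b
... | _ | d , inj₂ refl | b≡ = d , sym b≡
... | _ | d , inj₁ refl | b≡ = ⊥-elim (differ (sym (begin
        b % 2           ≡⟨ cong (_% 2) (sym b≡) ⟩
        (d * 2 + a) % 2 ≡⟨ %-remove-+ˡ a (n∣m*n d) ⟩
        a % 2           ∎)))
  where open ≡-Reasoning

equalParity : (R : ℕ → ℕ → Set) → (∀ {a b} → R a b → R b a) →
  (∀ a d → ¬ R a (suc (d * 2) + a)) → ∀ {a b} → R a b → a % 2 ≡ b % 2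
equalParity R R-sym noOdd {a} {b} r with a % 2 ≟ b % 2 | ≤-total a b
... | yes same  | _        = same
... | no differ | inj₁ a≤b with oddDistance a≤b differ
...   | d , refl = ⊥-elim (noOdd a d r)
equalParity R R-sym noOdd {a} {b} r | no differ | inj₂ b≤a with oddDistance b≤a (λ e → differ (sym e))
...   | d , refl = ⊥-elim (noOdd b d (R-sym r))

tooLong : ∀ n a → ¬ (suc (n + a) ≤ a)
tooLong n a h = <-irrefl refl (≤-trans (s≤s (m≤n+m a n)) h)

shift-bound : ∀ {k b m} → b ≤ k → m ≤ k ∸ b → b + m ≤ k
shift-bound {k} {b} {m} b≤k m≤ = subst (b + m ≤_) (m+[n∸m]≡n b≤k) (+-monoʳ-≤ b m≤)

module _ (G : Graph) where
  open Graph G using (Adj; irrefl) renaming (sym to adj-sym)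

  adj⇒≢ : ∀ {a b} → Adj a b → a ≢ b
  adj⇒≢ ab refl = irrefl ab

  lookup-injective : ∀ {xs : List (V G)} → Unique xs → ∀ i j → lookup xs i ≡ lookup xs j → i ≡ j
  lookup-injective (_ ∷ _) zero zero _ = refl
  lookup-injective (x≢ ∷ _) zero (suc j) eq = ⊥-elim (All.lookup x≢ (∈-lookup j) eq)
  lookup-injective (x≢ ∷ _) (suc i) zero eq = ⊥-elim (All.lookup x≢ (∈-lookup i) (sym eq))
  lookup-injective (_ ∷ distinct) (suc i) (suc j) eq = cong suc (lookup-injective distinct i j eq)

  lookup-linked : ∀ {x xs} → Linked Adj (x ∷ xs) → (i : Fin (length xs)) →
    Adj (lookup (x ∷ xs) (inject₁ i)) (lookup (x ∷ xs) (suc i))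
  lookup-linked [-] ()
  lookup-linked (xy ∷ _) zero = xy
  lookup-linked (_ ∷ rest) (suc i) = lookup-linked rest i

  listPath : (x : V G) (xs : List (V G)) → Unique (x ∷ xs) → Linked Adj (x ∷ xs) → Path G (length xs)
  listPath x xs distinct linked = record
    { vertex = lookup (x ∷ xs)
    ; inj = λ {i} {j} → lookup-injective distinct i j
    ; adj = lookup-linked linked }

  path₃ : ∀ {a b c} → a ≢ c → Adj a b → Adj b c → Path G 2
  path₃ {a} {b} {c} a≢c ab bc =
    listPath a (b ∷ c ∷ []) ((adj⇒≢ ab ∷ a≢c ∷ []) ∷ (adj⇒≢ bc ∷ []) ∷ [] ∷ []) (ab ∷ bc ∷ [-])

  path₃-avoids : ∀ {a b c z} (a≢c : a ≢ c) (ab : Adj a b) (bc : Adj b c) →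
    ¬ Adj a z → ¬ Adj b z → ¬ Adj c z → AvoidsN G (path₃ a≢c ab bc) z
  path₃-avoids _ _ _ a≁z _ _ zero = a≁z
  path₃-avoids _ _ _ _ b≁z _ (suc zero) = b≁z
  path₃-avoids _ _ _ _ _ c≁z (suc (suc zero)) = c≁z

  girth-weaken : ∀ {g} → GirthAtLeast G (suc g) → GirthAtLeast G g
  girth-weaken girth k cycle = ≤-trans (n≤1+n _) (girth k cycle)

  noTriangle : GirthAtLeast G 4 → ∀ {a b c} → Adj a b → Adj b c → Adj c a → ⊥
  noTriangle girth ab bc ca = <-irrefl refl (girth 3 (path₃ (adj⇒≢ (adj-sym ca)) ab bc , ca))

  noSquare : GirthAtLeast G 5 → ∀ {a b c d} → a ≢ c → b ≢ d →
    Adj a b → Adj b c → Adj c d → Adj d a → ⊥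
  noSquare girth {a} {b} {c} {d} a≢c b≢d ab bc cd da = <-irrefl refl (girth 4 (square , da))
    where
    square : Path G 3
    square = listPath a (b ∷ c ∷ d ∷ [])
      ( (adj⇒≢ ab ∷ a≢c ∷ adj⇒≢ (adj-sym da) ∷ [])
      ∷ (adj⇒≢ bc ∷ b≢d ∷ []) ∷ (adj⇒≢ cd ∷ []) ∷ [] ∷ [])
      (ab ∷ bc ∷ cd ∷ [-])

  -- A path with k edges read at natural-number positions 0 … k
  -- (values beyond k are irrelevant); convenient for cutting and gluing.
  record IPath (k : ℕ) : Set where
    field
      at       : ℕ → V G
      distinct : ∀ {m m'} → m ≤ k → m' ≤ k → at m ≡ at m' → m ≡ m'
      steps    : ∀ {m} → m < k → Adj (at m) (at (suc m))
  open IPath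

  Visits : ∀ {k} → IPath k → V G → Set
  Visits {k} p v = ∃[ m ] (m ≤ k × at p m ≡ v)

  toPath : ∀ {k} → IPath k → Path G k
  toPath p = record
    { vertex = λ i → at p (toℕ i)
    ; inj = λ {i} {j} eq → toℕ-injective (distinct p (toℕ≤pred[n] i) (toℕ≤pred[n] j) eq)
    ; adj = λ i → subst (λ m → Adj (at p m) (at p (suc (toℕ i)))) (sym (toℕ-inject₁ i))
                        (steps p (toℕ<n i)) }

  toPath-end : ∀ {k} (p : IPath k) → end G (toPath p) ≡ at p k
  toPath-end {k} p = cong (at p) (toℕ-fromℕ k)

  toℕ-mod : ∀ {m k} → m ≤ k → toℕ (m mod suc k) ≡ m
  toℕ-mod m≤k = trans (toℕ-fromℕ< _) (m<n⇒m%n≡m (s≤s m≤k))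

  fromPath : ∀ {k} → Path G k → IPath k
  fromPath {k} p = record
    { at = λ m → vertex p (m mod suc k)
    ; distinct = λ m≤k m'≤k eq →
        trans (sym (toℕ-mod m≤k)) (trans (cong toℕ (inj p eq)) (toℕ-mod m'≤k))
    ; steps = λ {m} m<k → subst₂ (λ i j → Adj (vertex p i) (vertex p j))
        (toℕ-injective (trans (toℕ-inject₁ _) (trans (toℕ-fromℕ< m<k) (sym (toℕ-mod (<⇒≤ m<k))))))
        (toℕ-injective (trans (cong suc (toℕ-fromℕ< m<k)) (sym (toℕ-mod m<k))))
        (adj p (fromℕ< m<k)) }

  fromPath-vertex : ∀ {k} (p : Path G k) i → at (fromPath p) (toℕ i) ≡ vertex p i
  fromPath-vertex p i = cong (vertex p) (toℕ-injective (toℕ-mod (toℕ≤pred[n] i)))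

  fromPath-end : ∀ {k} (p : Path G k) → at (fromPath p) k ≡ end G p
  fromPath-end {k} p = trans (cong (at (fromPath p)) (sym (toℕ-fromℕ k))) (fromPath-vertex p (fromℕ k))

  fromPath-visits : ∀ {k v} (p : Path G k) → Visits (fromPath p) v → OnPath G p v
  fromPath-visits {k} p (m , _ , eq) = m mod suc k , eq

  take : ∀ {k} a → a ≤ k → IPath k → IPath a
  take a a≤k p = record
    { at = at p
    ; distinct = λ m≤a m'≤a → distinct p (≤-trans m≤a a≤k) (≤-trans m'≤a a≤k)
    ; steps = λ m<a → steps p (<-≤-trans m<a a≤k) }

  take-visits : ∀ {k a v} (a≤k : a ≤ k) (p : IPath k) → Visits (take a a≤k p) v → Visits p v
  take-visits a≤k p (m , m≤a , eq) = m , ≤-trans m≤a a≤k , eq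

  drop : ∀ {k} b → b ≤ k → IPath k → IPath (k ∸ b)
  drop {k} b b≤k p = record
    { at = λ m → at p (b + m)
    ; distinct = λ m≤ m'≤ eq →
        +-cancelˡ-≡ b _ _ (distinct p (shift-bound b≤k m≤) (shift-bound b≤k m'≤) eq)
    ; steps = λ {m} m< → subst (λ i → Adj (at p (b + m)) (at p i)) (sym (+-suc b m))
                                (steps p (subst (_≤ k) (+-suc b m) (shift-bound b≤k m<))) }

  drop-visits : ∀ {k b v} (b≤k : b ≤ k) (p : IPath k) → Visits (drop b b≤k p) v →
    ∃[ m ] (b ≤ m × m ≤ k × at p m ≡ v)
  drop-visits {k} {b} b≤k p (j , j≤ , eq) =
    b + j , m≤m+n b j , shift-bound b≤k j≤ , eq

  glue : ℕ → (ℕ → V G) → (ℕ → V G) → ℕ → V G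
  glue zero    f g zero    = f zero
  glue zero    f g (suc m) = g m
  glue (suc k) f g zero    = f zero
  glue (suc k) f g (suc m) = glue k (λ i → f (suc i)) g m

  glue-left : ∀ k {m} f g → m ≤ k → glue k f g m ≡ f m
  glue-left zero    f g z≤n = refl
  glue-left (suc k) f g z≤n = refl
  glue-left (suc k) f g (s≤s m≤k) = glue-left k (λ i → f (suc i)) g m≤k

  glue-right : ∀ k j f g → glue k f g (suc k + j) ≡ g j
  glue-right zero    j f g = refl
  glue-right (suc k) j f g = glue-right k j (λ i → f (suc i)) g

  data Side (k : ℕ) : ℕ → Set where
    left  : ∀ {m} → m ≤ k → Side k m
    right : ∀ j → Side k (suc k + j)

  side : ∀ k m → Side k m
  side zero    zero    = left z≤n
  side zero    (suc m) = right m
  side (suc k) zero    = left z≤n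
  side (suc k) (suc m) with side k m
  ... | left m≤k = left (s≤s m≤k)
  ... | right j  = right j

  Disjoint : ∀ {k k'} → IPath k → IPath k' → Set
  Disjoint p q = ∀ v → Visits p v → Visits q v → ⊥

  join : ∀ {k k'} (p : IPath k) (q : IPath k') → Disjoint p q → Adj (at p k) (at q 0) →
    IPath (suc (k + k'))
  join {k} {k'} p q disjoint seam = record { at = glue k (at p) (at q) ; distinct = dist ; steps = step }
    where
    onLeft : ∀ {m} → m ≤ k → glue k (at p) (at q) m ≡ at p m
    onLeft = glue-left k (at p) (at q)
    onRight : ∀ j → glue k (at p) (at q) (suc k + j) ≡ at q j
    onRight j = glue-right k j (at p) (at q)

    dist : ∀ {m m'} → m ≤ suc (k + k') → m' ≤ suc (k + k') →
      glue k (at p) (at q) m ≡ glue k (at p) (at q) m' → m ≡ m'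
    dist {m} {m'} m≤ m'≤ eq with side k m | side k m'
    ... | left a | left b = distinct p a b (trans (sym (onLeft a)) (trans eq (onLeft b)))
    ... | left a | right j = ⊥-elim (disjoint _ (m , a , refl)
          (j , +-cancelˡ-≤ (suc k) _ _ m'≤ , sym (trans (sym (onLeft a)) (trans eq (onRight j)))))
    ... | right j | left b = ⊥-elim (disjoint _ (m' , b , refl)
          (j , +-cancelˡ-≤ (suc k) _ _ m≤ , trans (sym (onRight j)) (trans eq (onLeft b))))
    ... | right j | right j' = cong (λ j → suc k + j)
          (distinct q (+-cancelˡ-≤ (suc k) _ _ m≤) (+-cancelˡ-≤ (suc k) _ _ m'≤)
                      (trans (sym (onRight j)) (trans eq (onRight j'))))

    step : ∀ {m} → m < suc (k + k') → Adj (glue k (at p) (at q) m) (glue k (at p) (at q) (suc m))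
    step {m} m< with side k m
    ... | right j = subst₂ Adj (sym (onRight j))
          (sym (trans (cong (glue k (at p) (at q)) (sym (+-suc (suc k) j))) (onRight (suc j))))
          (steps q (+-cancelˡ-< (suc k) j k' m<))
    ... | left m≤k with m≤n⇒m<n∨m≡n m≤k
    ...   | inj₁ m<k = subst₂ Adj (sym (onLeft (<⇒≤ m<k))) (sym (onLeft m<k)) (steps p m<k)
    ...   | inj₂ refl = subst₂ Adj (sym (onLeft ≤-refl))
          (sym (trans (cong (glue k (at p) (at q)) (sym (+-identityʳ (suc k)))) (onRight 0)))
          seam

  join-visits : ∀ {k k' v} (p : IPath k) (q : IPath k') disjoint seam →
    Visits (join p q disjoint seam) v → Visits p v ⊎ Visits q v
  join-visits {k} p q _ _ (m , m≤ , eq) with side k m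
  ... | left a  = inj₁ (m , a , trans (sym (glue-left k (at p) (at q) a)) eq)
  ... | right j = inj₂ (j , +-cancelˡ-≤ (suc k) _ _ m≤ , trans (sym (glue-right k j (at p) (at q))) eq)

  module ShortestPath {L} (P : Path G L) {x y} (shortest : IsShortestPath G P x y) where
    Pᵢ : IPath L
    Pᵢ = fromPath P

    U : ℕ → V G
    U = at Pᵢ

    U-on : ∀ {m} → m ≤ L → OnPath G P (U m)
    U-on {m} m≤L = fromPath-visits P (m , m≤L , refl)

    off≢U : ∀ {v m} → ¬ OnPath G P v → m ≤ L → v ≢ U m
    off≢U off m≤L refl = off (U-on m≤L)

    detour : ∀ {l a b} (D : Path G l) → (∀ i → ¬ OnPath G P (vertex D i)) →
      Adj (U a) (start G D) → Adj (end G D) (U b) → b ≤ L → b ≤ suc (suc (l + a))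
    detour {l} {a} {b} D off aD Db b≤L with b ≤? suc (suc (l + a))
    ... | yes close = close
    ... | no far = contradiction (proj₂ shortest _ (toPath shortcut) (shortcut-start , shortcut-end))
                                 (<⇒≱ shorter)
      where
      far′ : suc (suc (suc (l + a))) ≤ b
      far′ = ≰⇒> far
      a≤L : a ≤ L
      a≤L = ≤-trans (m≤n+m a (suc (suc (suc l)))) (≤-trans far′ b≤L)
      Dᵢ : IPath l
      Dᵢ = fromPath D
      prefix : IPath a
      prefix = take a a≤L Pᵢ
      suffix : IPath (L ∸ b)
      suffix = drop b b≤L Pᵢ

      offD : ∀ {v} → Visits Dᵢ v → ¬ OnPath G P v
      offD inD with fromPath-visits D inD
      ... | i , refl = off i

      disjoint₁ : Disjoint prefix Dᵢ
      disjoint₁ v inPrefix inD = offD inD (fromPath-visits P (take-visits a≤L Pᵢ inPrefix))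

      seam₁ : Adj (U a) (at Dᵢ 0)
      seam₁ = subst (Adj (U a)) (sym (fromPath-vertex D zero)) aD

      middle : IPath (suc (a + l))
      middle = join prefix Dᵢ disjoint₁ seam₁

      -- A suffix vertex U m (m ≥ b) is neither in D nor a prefix vertex U m' (m' ≤ a < b).
      disjoint₂ : Disjoint middle suffix
      disjoint₂ v inMiddle inSuffix with drop-visits b≤L Pᵢ inSuffix | join-visits prefix Dᵢ disjoint₁ seam₁ inMiddle
      ... | m , _ , m≤L , eq | inj₂ inD = offD inD (fromPath-visits P (m , m≤L , eq))
      ... | m , b≤m , m≤L , refl | inj₁ (m' , m'≤a , eq) =
            tooLong (suc (suc l)) a (≤-trans far′ (≤-trans b≤m
              (subst (_≤ a) (distinct Pᵢ (≤-trans m'≤a a≤L) m≤L eq) m'≤a)))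

      seam₂ : Adj (at middle (suc (a + l))) (at suffix 0)
      seam₂ = subst₂ Adj (sym (trans (glue-right a l U (at Dᵢ)) (fromPath-end D)))
                         (cong U (sym (+-identityʳ b))) Db

      -- x … U a, then D, then U b … y: an x-y path shorter than P.
      shortcut : IPath (suc (suc (a + l) + (L ∸ b)))
      shortcut = join middle suffix disjoint₂ seam₂

      shortcut-start : start G (toPath shortcut) ≡ x
      shortcut-start = trans (glue-left (suc (a + l)) (at middle) (at suffix) z≤n)
        (trans (glue-left a U (at Dᵢ) z≤n) (trans (fromPath-vertex P zero) (proj₁ (proj₁ shortest))))

      shortcut-end : end G (toPath shortcut) ≡ y
      shortcut-end = trans (toPath-end shortcut) (trans (glue-right (suc (a + l)) (L ∸ b) (at middle) (at suffix))
        (trans (cong U (m+[n∸m]≡n b≤L)) (trans (fromPath-end P) (proj₂ (proj₁ shortest)))))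

      shorter : suc (suc (a + l) + (L ∸ b)) < L
      shorter = subst (suc (suc (suc (a + l))) + (L ∸ b) ≤_) (m+[n∸m]≡n b≤L)
        (+-monoˡ-≤ (L ∸ b) (subst (λ s → suc (suc (suc s)) ≤ b) (+-comm l a) far′))

    SharedNeighbour : ℕ → ℕ → Set
    SharedNeighbour a b = a ≤ L × b ≤ L × ∃[ v ] (¬ OnPath G P v × Adj v (U a) × Adj v (U b))

    SharedNeighbour-sym : ∀ {a b} → SharedNeighbour a b → SharedNeighbour b a
    SharedNeighbour-sym (a≤L , b≤L , v , off , va , vb) = b≤L , a≤L , v , off , vb , va

    EdgeLinked : ℕ → ℕ → Set
    EdgeLinked a b = a ≤ L × b ≤ L ×
      ∃[ v ] ∃[ w ] (¬ OnPath G P v × ¬ OnPath G P w × Adj v w × Adj v (U a) × Adj w (U b))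

    EdgeLinked-sym : ∀ {a b} → EdgeLinked a b → EdgeLinked b a
    EdgeLinked-sym (a≤L , b≤L , v , w , offv , offw , vw , va , wb) =
      b≤L , a≤L , w , v , offw , offv , adj-sym vw , wb , va

    -- A common neighbour at odd distance 1 closes a triangle; at larger odd distance it is a detour.
    noSharedNeighbourAtOddGap : GirthAtLeast G 5 → ∀ a d → ¬ SharedNeighbour a (suc (d * 2) + a)
    noSharedNeighbourAtOddGap girth a zero (_ , b≤L , v , _ , va , vb) =
      noTriangle (girth-weaken girth) va (steps Pᵢ b≤L) (adj-sym vb)
    noSharedNeighbourAtOddGap girth a (suc d) (_ , b≤L , v , off , va , vb) =
      tooLong (d * 2) a (≤-pred (≤-pred
        (detour (listPath v [] ([] ∷ []) [-]) (λ { zero → off }) (adj-sym va) vb b≤L)))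

    -- Distance 3: U a, U (2 + a), w form an asteroidal triple.
    noAsteroidalLink : GirthAtLeast G 5 → ATFree G → ∀ a {v w} → 3 + a ≤ L →
      ¬ OnPath G P v → ¬ OnPath G P w → Adj v w → Adj v (U a) → Adj w (U (3 + a)) → ⊥
    noAsteroidalLink girth atFree a {v} {w} b≤L offv offw vw va wb =
      atFree p₀ p₂ w
        ( p₀≢p₂ , p₂≢w , p₀≢w , p₀≁p₂ , p₂≁w , p₀≁w
        , (2 , path₃ p₀≢p₂ e₀₁ e₁₂ , (refl , refl) ,
           path₃-avoids p₀≢p₂ e₀₁ e₁₂ p₀≁w p₁≁w p₂≁w)
        , (2 , path₃ p₂≢w e₂₃ (adj-sym wb) , (refl , refl) ,
           path₃-avoids p₂≢w e₂₃ (adj-sym wb) (λ h → p₀≁p₂ (adj-sym h)) p₃≁p₀ (λ h → p₀≁w (adj-sym h)))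
        , (2 , path₃ p₀≢w (adj-sym va) vw , (refl , refl) ,
           path₃-avoids p₀≢w (adj-sym va) vw p₀≁p₂ v≁p₂ (λ h → p₂≁w (adj-sym h))) )
      where
      p₀ p₁ p₂ p₃ : V G
      p₀ = U a
      p₁ = U (1 + a)
      p₂ = U (2 + a)
      p₃ = U (3 + a)
      2+a≤L : 2 + a ≤ L
      2+a≤L = <⇒≤ b≤L
      1+a≤L : 1 + a ≤ L
      1+a≤L = <⇒≤ 2+a≤L
      a≤L : a ≤ L
      a≤L = <⇒≤ 1+a≤L
      e₀₁ : Adj p₀ p₁
      e₀₁ = steps Pᵢ 1+a≤L
      e₁₂ : Adj p₁ p₂
      e₁₂ = steps Pᵢ 2+a≤L
      e₂₃ : Adj p₂ p₃
      e₂₃ = steps Pᵢ b≤L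
      p₀≢p₂ : p₀ ≢ p₂
      p₀≢p₂ eq = m≢1+n+m a {1} (distinct Pᵢ a≤L 2+a≤L eq)
      p₁≢p₃ : p₁ ≢ p₃
      p₁≢p₃ eq = m≢1+n+m (1 + a) {1} (distinct Pᵢ 1+a≤L b≤L eq)
      p₂≢w : p₂ ≢ w
      p₂≢w eq = off≢U offw 2+a≤L (sym eq)
      p₀≢w : p₀ ≢ w
      p₀≢w eq = off≢U offw a≤L (sym eq)
      p₀≁p₂ : ¬ Adj p₀ p₂
      p₀≁p₂ h = noTriangle (girth-weaken girth) e₀₁ e₁₂ (adj-sym h)
      p₂≁w : ¬ Adj p₂ w
      p₂≁w h = noTriangle (girth-weaken girth) h wb (adj-sym e₂₃)
      p₀≁w : ¬ Adj p₀ w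
      p₀≁w h = noSharedNeighbourAtOddGap girth a 1 (a≤L , b≤L , w , offw , adj-sym h , wb)
      p₁≁w : ¬ Adj p₁ w
      p₁≁w h = noSquare girth (off≢U offw 2+a≤L) p₁≢p₃ (adj-sym h) e₁₂ e₂₃ (adj-sym wb)
      p₃≁p₀ : ¬ Adj p₃ p₀
      p₃≁p₀ h = noSquare girth p₀≢p₂ p₁≢p₃ e₀₁ e₁₂ e₂₃ h
      v≁p₂ : ¬ Adj v p₂
      v≁p₂ h = noSquare girth (off≢U offv 1+a≤L) p₀≢p₂ va e₀₁ e₁₂ (adj-sym h)

    -- An edge linking odd distance 1 closes a 4-cycle, distance 3 gives an
    -- asteroidal triple, and any larger odd distance is a detour.
    noEdgeLinkAtOddGap : GirthAtLeast G 5 → ATFree G → ∀ a d → ¬ EdgeLinked a (suc (d * 2) + a)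
    noEdgeLinkAtOddGap girth atFree a zero (a≤L , b≤L , v , w , offv , offw , vw , va , wb) =
      noSquare girth (off≢U offv b≤L) (λ eq → off≢U offw a≤L (sym eq))
        va (steps Pᵢ b≤L) (adj-sym wb) (adj-sym vw)
    noEdgeLinkAtOddGap girth atFree a (suc zero) (_ , b≤L , v , w , offv , offw , vw , va , wb) =
      noAsteroidalLink girth atFree a b≤L offv offw vw va wb
    noEdgeLinkAtOddGap girth atFree a (suc (suc d)) (_ , b≤L , v , w , offv , offw , vw , va , wb) =
      tooLong (suc (d * 2)) a (≤-pred (≤-pred (≤-pred
        (detour (listPath v (w ∷ []) ((adj⇒≢ vw ∷ []) ∷ [] ∷ []) (vw ∷ [-]))
                (λ { zero → offv ; (suc zero) → offw }) (adj-sym va) wb b≤L))))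

  meetsAt : ∀ {lo hi lo' hi'} (q : ℚ) → {True (lo ≤ℚ? q)} → {True (q ≤ℚ? hi)} →
    {True (lo' ≤ℚ? q)} → {True (q ≤ℚ? hi')} → Meet G (lo , hi) (lo' , hi')
  meetsAt q {p₁} {p₂} {p₃} {p₄} = q , (toWitness p₁ , toWitness p₂) , (toWitness p₃ , toWitness p₄)

  module Intervals {L} (P : Path G L) {x y} (shortest : IsShortestPath G P x y)
                   (girth : GirthAtLeast G 5) (atFree : ATFree G) where
    open ShortestPath P shortest
    open Construction G P

    toU : ∀ {v} i → Adj v (u i) → Adj v (U (toℕ i))
    toU {v} i = subst (Adj v) (sym (fromPath-vertex P i))

    neighbourParity : ∀ i j {v} → InSi i v → Adj v (u j) → toℕ i % 2 ≡ toℕ j % 2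
    neighbourParity i j (off , vi) vj =
      equalParity SharedNeighbour SharedNeighbour-sym (noSharedNeighbourAtOddGap girth)
        (toℕ≤pred[n] i , toℕ≤pred[n] j , _ , off , toU i vi , toU j vj)

    edgeParity : ∀ i j {v w} → InSi i v → InSi j w → Adj v w → toℕ i % 2 ≡ toℕ j % 2
    edgeParity i j (offv , vi) (offw , wj) vw =
      equalParity EdgeLinked EdgeLinked-sym (noEdgeLinkAtOddGap girth atFree)
        (toℕ≤pred[n] i , toℕ≤pred[n] j , _ , _ , offv , offw , vw , toU i vi , toU j wj)

    lonely : ∀ {i j v w} → InSi i v → ¬ InSet v → InSi j w → Adj v w → ⊥
    lonely (offv , _) notS (offw , _) vw = notS (offv , _ , offw , vw)

    clash : ∀ {r s : ℕ} → r ≡ 0 → s ≡ 1 → r ≡ s → ⊥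
    clash odd even same = 0≢1+n (trans (sym odd) (trans same even))

    edgeIntervalsMeet : ∀ {a b J K} → Adj a b → g₂ a J → g₂ b K → Meet G J K
    edgeIntervalsMeet h (path-odd i o) (path-odd j _)         = meetsAt (+ 1 / 1)
    edgeIntervalsMeet h (path-odd i o) (path-even j _)        = meetsAt (+ 2 / 1)
    edgeIntervalsMeet h (path-odd i o) (noS-odd j v _ _ _)    = meetsAt (+ 3 / 2)
    edgeIntervalsMeet h (path-odd i o) (noS-even j v vS _ e)  = ⊥-elim (clash o e (sym (neighbourParity j i vS (adj-sym h))))
    edgeIntervalsMeet h (path-odd i o) (S-odd j v _ _ _)      = meetsAt (+ 1 / 1)
    edgeIntervalsMeet h (path-odd i o) (S-even j v vS _ e)    = ⊥-elim (clash o e (sym (neighbourParity j i vS (adj-sym h))))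
    edgeIntervalsMeet h (path-even i e) (path-odd j _)        = meetsAt (+ 2 / 1)
    edgeIntervalsMeet h (path-even i e) (path-even j _)       = meetsAt (+ 2 / 1)
    edgeIntervalsMeet h (path-even i e) (noS-odd j v vS _ o)  = ⊥-elim (clash o e (neighbourParity j i vS (adj-sym h)))
    edgeIntervalsMeet h (path-even i e) (noS-even j v _ _ _)  = meetsAt (+ 5 / 2)
    edgeIntervalsMeet h (path-even i e) (S-odd j v vS _ o)    = ⊥-elim (clash o e (neighbourParity j i vS (adj-sym h)))
    edgeIntervalsMeet h (path-even i e) (S-even j v _ _ _)    = meetsAt (+ 3 / 1)
    edgeIntervalsMeet h (noS-odd i v _ _ _) (path-odd j _)    = meetsAt (+ 3 / 2)
    edgeIntervalsMeet h (noS-odd i v vS _ o) (path-even j e)  = ⊥-elim (clash o e (neighbourParity i j vS h))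
    edgeIntervalsMeet h (noS-odd i v vS l _) (noS-odd j w wS _ _)  = ⊥-elim (lonely vS l wS h)
    edgeIntervalsMeet h (noS-odd i v vS l _) (noS-even j w wS _ _) = ⊥-elim (lonely vS l wS h)
    edgeIntervalsMeet h (noS-odd i v vS l _) (S-odd j w wS _ _)    = ⊥-elim (lonely vS l wS h)
    edgeIntervalsMeet h (noS-odd i v vS l _) (S-even j w wS _ _)   = ⊥-elim (lonely vS l wS h)
    edgeIntervalsMeet h (noS-even i v vS _ e) (path-odd j o)  = ⊥-elim (clash o e (sym (neighbourParity i j vS h)))
    edgeIntervalsMeet h (noS-even i v _ _ _) (path-even j _)  = meetsAt (+ 5 / 2)
    edgeIntervalsMeet h (noS-even i v vS l _) (noS-odd j w wS _ _)  = ⊥-elim (lonely vS l wS h)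
    edgeIntervalsMeet h (noS-even i v vS l _) (noS-even j w wS _ _) = ⊥-elim (lonely vS l wS h)
    edgeIntervalsMeet h (noS-even i v vS l _) (S-odd j w wS _ _)    = ⊥-elim (lonely vS l wS h)
    edgeIntervalsMeet h (noS-even i v vS l _) (S-even j w wS _ _)   = ⊥-elim (lonely vS l wS h)
    edgeIntervalsMeet h (S-odd i v _ _ _) (path-odd j _)      = meetsAt (+ 1 / 1)
    edgeIntervalsMeet h (S-odd i v vS _ o) (path-even j e)    = ⊥-elim (clash o e (neighbourParity i j vS h))
    edgeIntervalsMeet h (S-odd i v vS _ _) (noS-odd j w wS l _)    = ⊥-elim (lonely wS l vS (adj-sym h))
    edgeIntervalsMeet h (S-odd i v vS _ _) (noS-even j w wS l _)   = ⊥-elim (lonely wS l vS (adj-sym h))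
    edgeIntervalsMeet h (S-odd i v _ _ _) (S-odd j w _ _ _)        = meetsAt (+ 1 / 2)
    edgeIntervalsMeet h (S-odd i v vS _ o) (S-even j w wS _ e)     = ⊥-elim (clash o e (edgeParity i j vS wS h))
    edgeIntervalsMeet h (S-even i v vS _ e) (path-odd j o)    = ⊥-elim (clash o e (sym (neighbourParity i j vS h)))
    edgeIntervalsMeet h (S-even i v _ _ _) (path-even j _)    = meetsAt (+ 3 / 1)
    edgeIntervalsMeet h (S-even i v vS _ _) (noS-odd j w wS l _)   = ⊥-elim (lonely wS l vS (adj-sym h))
    edgeIntervalsMeet h (S-even i v vS _ _) (noS-even j w wS l _)  = ⊥-elim (lonely wS l vS (adj-sym h))
    edgeIntervalsMeet h (S-even i v vS _ e) (S-odd j w wS _ o)     = ⊥-elim (clash o e (sym (edgeParity i j vS wS h)))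
    edgeIntervalsMeet h (S-even i v _ _ _) (S-even j w _ _ _)      = meetsAt (+ 7 / 2)

lemma7 : (G : Graph) → Connected G → ATFree G → GirthAtLeast G 5 →
    (x y : V G) → IsDominatingPair G x y → IsDiametral G x y →
    (L : ℕ) (P : Path G L) → IsShortestPath G P x y →
    ∀ a b → Graph.Adj G a b → Construction.AdjI₂ G P a b
lemma7 G _ atFree girth x y _ _ L P shortest a b ab =
  adj⇒≢ G ab , λ J K → Intervals.edgeIntervalsMeet G P shortest girth atFree ab
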